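{- Let $G=(V,E)$ be a finite simple undirected unweighted graph with $E\neq\emptyset$, and let $c$ be the minimum number of edges that must be removed from $G$ so that every connected component of the remaining graph is a clique (the cluster deletion value of $G$). Then there exists a family of at most $c+1$ clusterings of $V$, and $c+1\le |E|$, such that for every $\lambda\in(0,1)$ the family contains a clustering that is optimal for the LambdaPrime objective with parameter $\lambda$.
   Context: A clustering of $V$ is a partition $\mathcal{C}$ of $V$ into disjoint nonempty sets. For $S\subseteq V$, $\mathrm{cut}(S)$ denotes the number of edges with exactly one endpoint in $S$. For $\lambda\in(0,1)$, the LambdaPrime objective of a clustering $\mathcal{C}$ is $\mathrm{LamPrime}(\mathcal{C},\lambda)=\sum_{S\in\mathcal{C}}\left(\tfrac12\,\mathrm{cut}(S)+\lambda\binom{|S|}{2}\right)$, and a clustering is optimal for parameter $\lambda$ if it minimizes this quantity over all clusterings of $V$.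
   Formalization: The parameter $\lambda\in(0,1)$ of the LambdaPrime objective ranges only over the rationals. -}

module Defs where

open import Data.Bool using (Bool; true; false; _∧_; not; if_then_else_)
open import Data.Nat using (ℕ; zero; suc; _∸_; _<ᵇ_)
open import Data.Nat.Combinatorics using (_C_)
open import Data.Fin using (Fin; toℕ)
open import Data.Fin.Subset using (Subset; Nonempty; _∈_; _∩_; ⊥; ∣_∣)
open import Data.List using (List; []; _∷_; length; map; allFin; lookup)
open import Data.Nat.ListAction using (sum)
open import Data.List.Relation.Unary.All using (All)
open import Data.Vec using () renaming (lookup to vlookup)
open import Data.Product using (Σ; ∃; _×_; _,_)
open import Data.Integer using (+_)
open import Data.Rational using (ℚ; _/_; _+_; _*_; ½; _≤_)
open import Relation.Binary.PropositionalEquality using (_≡_; _≢_)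

record Graph (n : ℕ) : Set where
  field
    adj   : Fin n → Fin n → Bool
    sym   : ∀ u v → adj u v ≡ adj v u
    irrefl : ∀ v → adj v v ≡ false
open Graph public

count : {n : ℕ} → (Fin n → Bool) → ℕ
count {n} p = sum (map (λ v → if p v then 1 else 0) (allFin n))

numEdges : {n : ℕ} → Graph n → ℕ
numEdges {n} G = sum (map (λ u → count (λ v → adj G u v ∧ (toℕ u <ᵇ toℕ v))) (allFin n))

cut : {n : ℕ} → Graph n → Subset n → ℕ
cut {n} G S = sum (map (λ u → count (λ v → adj G u v ∧ (vlookup S u ∧ not (vlookup S v)))) (allFin n))

_⊆G_ : {n : ℕ} → Graph n → Graph n → Set
H ⊆G G = ∀ u v → adj H u v ≡ true → adj G u v ≡ true

data Reach {n : ℕ} (H : Graph n) : Fin n → Fin n → Set where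
  here : ∀ {u} → Reach H u u
  step : ∀ {u v w} → adj H u v ≡ true → Reach H v w → Reach H u w

AllComponentsCliques : {n : ℕ} → Graph n → Set
AllComponentsCliques H = ∀ u v → Reach H u v → u ≢ v → adj H u v ≡ true

IsClusterDeletionValue : {n : ℕ} → Graph n → ℕ → Set
IsClusterDeletionValue G c =
  (Σ (Graph _) λ H → H ⊆G G × AllComponentsCliques H × numEdges G ∸ numEdges H ≡ c)
  × (∀ (H : Graph _) → H ⊆G G → AllComponentsCliques H → c Data.Nat.≤ numEdges G ∸ numEdges H)

IsClustering : {n : ℕ} → List (Subset n) → Set
IsClustering {n} cs =
  All Nonempty cs
  × (∀ i j → i ≢ j → lookup cs i ∩ lookup cs j ≡ ⊥)
  × (∀ (v : Fin n) → ∃ λ i → v ∈ lookup cs i)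

Clustering : ℕ → Set
Clustering n = Σ (List (Subset n)) IsClustering

toℚ : ℕ → ℚ
toℚ k = + k / 1

lamPrimeList : {n : ℕ} → Graph n → List (Subset n) → ℚ → ℚ
lamPrimeList G [] lam = + 0 / 1
lamPrimeList G (S ∷ cs) lam =
  (½ * toℚ (cut G S) + lam * toℚ (∣ S ∣ C 2)) + lamPrimeList G cs lam

LamPrime : {n : ℕ} → Graph n → Clustering n → ℚ → ℚ
LamPrime G (cs , _) lam = lamPrimeList G cs lam

Optimal : {n : ℕ} → Graph n → Clustering n → ℚ → Set
Optimal {n} G Cl lam = ∀ (D : Clustering n) → LamPrime G Cl lam ≤ LamPrime G D lam

{-# OPTIONS --safe #-}
-- Write x for the number of edges a clustering cuts and B for its number of
-- intra-cluster pairs, so that LamPrime = x + λB. Every edge is either cut or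
-- inside a cluster, hence x + B ≥ |E| for every clustering, while grouping the
-- vertices by the components of an optimal cluster deletion graph gives x = c and
-- x + B = |E|. Since x + λB = (1 − λ)x + λ(x + B), for λ ∈ (0,1) that clustering
-- is at least as good as any clustering with x > c, and a clustering with x ≤ c
-- is at least matched by one that cuts the same number of edges with the fewest
-- intra-cluster pairs. Such minimisers for x = 0, …, c form the family, and
-- c < |E| because a single edge of G is itself a cluster graph.
module Submission where

open import Data.Bool using (Bool; true; false; _∧_; _∨_; not; if_then_else_)
import Data.Bool as Bool
open import Data.Bool.Properties using (∨-zeroʳ; ∧-zeroʳ; ∧-identityʳ; ∧-assoc; ∧-comm; ⇔→≡; T-≡)
open import Data.Fin using (Fin; zero; suc; toℕ)
open import Data.Fin.Properties using (_≟_; toℕ-injective; any?)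
open import Data.Fin.Subset using (Subset; ∣_∣; _∩_; Nonempty) renaming (⊥ to ∅; _∈_ to _∈ˢ_)
open import Data.Fin.Subset.Properties using (x∈p∩q⁺; x∈p∩q⁻; ∉⊥; ∩-comm; Empty-unique)
import Data.Integer as ℤ
import Data.Integer.Properties as ℤ
open import Data.List
  using (List; []; _∷_; lookup; length; map; allFin; tabulate; deduplicate; cartesianProductWith; filter; upTo)
open import Data.List.Properties using (map-tabulate; length-map; length-upTo)
import Data.List.Extrema
open import Data.List.Extrema.Nat using (argmin; argmin-all; f[argmin]≤f[⊤]; f[argmin]≤f[xs])
open import Data.List.Membership.Propositional using (_∈_)
open import Data.List.Membership.Propositional.Properties
  using ( ∈-lookup; ∈-map⁺; ∈-map⁻; ∈-allFin; ∈-deduplicate⁺; ∈-deduplicate⁻; ∈-cartesianProductWith⁺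
        ; ∈-filter⁺; ∈-upTo⁺)
open import Data.List.Relation.Unary.All as All using (All)
import Data.List.Relation.Unary.All.Properties as All
open import Data.List.Relation.Unary.AllPairs as AllPairs using (AllPairs; _∷_)
import Data.List.Relation.Unary.AllPairs.Properties as AllPairs
open import Data.List.Relation.Unary.Any as Any using (here; there)
open import Data.List.Relation.Unary.Any.Properties using (lookup-index)
open import Data.List.Relation.Unary.Unique.DecPropositional.Properties using (deduplicate-!)
open import Data.Nat as ℕ using (ℕ; zero; suc; _+_; _*_; _∸_; _≤_; _<_; _<ᵇ_; _≤?_; z≤n; s≤s)
open import Data.Nat.Properties hiding (_≟_)
open import Algebra.Properties.Semiring.Sum +-*-semiring
  using (sum-syntax; ∑-comm; ∑-distrib-+; sum-cong-≗; sum-replicate-zero)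
open import Data.Nat.Combinatorics using (_C_; nC1≡n; nCk+nC[k+1]≡[n+1]C[k+1])
import Data.Nat.Coprimality as Coprimality
import Data.Nat.ListAction as List
open import Data.Product using (Σ; ∃; _×_; _,_; proj₁; proj₂)
open import Data.Rational using (ℚ; mkℚ; _/_; -_; *≤*; nonNegative; NonNegative; ½; 0ℚ; 1ℚ)
  renaming (_+_ to _+ℚ_; _*_ to _*ℚ_; _-_ to _-ℚ_; _≤_ to _≤ℚ_; _<_ to _<ℚ_)
import Data.Rational.Properties as ℚₚ
open import Data.Rational.Solver using (module +-*-Solver)
open import Data.Sum as Sum using (_⊎_; inj₁; inj₂)
open import Data.Vec using (Vec; []; _∷_) renaming (lookup to vlookup)
import Data.Vec as Vec
open import Data.Vec.Properties using ([]=⇒lookup; lookup⇒[]=; lookup∘tabulate; tabulate-cong; ≡-dec)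
open import Function using (_∘_)
open import Function.Bundles using (Equivalence; mk⇔)
open import Relation.Binary.Bundles using (DecTotalOrder)
open import Relation.Binary.Definitions using (DecidableEquality)
open import Relation.Binary.PropositionalEquality hiding ([_])
open import Relation.Binary.Structures using (IsEquivalence)
open import Relation.Nullary using (Dec; does; yes; no; contradiction)
open import Relation.Nullary.Decidable using (dec-true; dec-false; does-⇔)
open import Relation.Unary using (Decidable)
open import Defs hiding (sym)

module ℚExtrema = Data.List.Extrema (DecTotalOrder.totalOrder ℚₚ.≤-decTotalOrder)

[_] : Bool → ℕ
[ b ] = if b then 1 else 0

∧-swapˡ : ∀ a b c → a ∧ (b ∧ c) ≡ b ∧ (a ∧ c)
∧-swapˡ a b c = trans (sym (∧-assoc a b c)) (trans (cong (_∧ c) (∧-comm a b)) (∧-assoc b a c))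

does-sym : ∀ {A : Set} (_≟ᴬ_ : DecidableEquality A) x y → does (x ≟ᴬ y) ≡ does (y ≟ᴬ x)
does-sym _≟ᴬ_ x y = does-⇔ (mk⇔ sym sym) (x ≟ᴬ y) (y ≟ᴬ x)

does⇒witness : ∀ {A : Set} (a? : Dec A) → does a? ≡ true → A
does⇒witness (yes a) _ = a

<ᵇ-trichotomy : ∀ {a b} → a ≢ b → [ a <ᵇ b ] + [ b <ᵇ a ] ≡ 1
<ᵇ-trichotomy {zero} {zero} a≢b = contradiction refl a≢b
<ᵇ-trichotomy {zero} {suc b} a≢b = refl
<ᵇ-trichotomy {suc a} {zero} a≢b = refl
<ᵇ-trichotomy {suc a} {suc b} a≢b = <ᵇ-trichotomy (a≢b ∘ cong suc)

∑-mono : ∀ {m} {f g : Fin m → ℕ} → (∀ i → f i ≤ g i) → ∑[ i < m ] f i ≤ ∑[ i < m ] g i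
∑-mono {zero} f≤g = z≤n
∑-mono {suc m} f≤g = +-mono-≤ (f≤g zero) (∑-mono (λ i → f≤g (suc i)))

∑-term : ∀ {m} (f : Fin m → ℕ) i → f i ≤ ∑[ j < m ] f j
∑-term f zero = m≤m+n (f zero) _
∑-term {suc m} f (suc i) = ≤-trans (∑-term (λ j → f (suc j)) i) (m≤n+m _ (f zero))

∑-δ : ∀ {m} (j : Fin m) (b : Fin m → Bool) → ∑[ i < m ] [ does (i ≟ j) ∧ b i ] ≡ [ b j ]
∑-δ {suc m} zero b = trans (cong ([ b zero ] +_) (sum-replicate-zero m)) (+-identityʳ _)
∑-δ {suc m} (suc j) b = ∑-δ j (λ i → b (suc i))

∑∑-distrib-+ : ∀ {n} (f g : Fin n → Fin n → ℕ) →
               ∑[ u < n ] ∑[ v < n ] (f u v + g u v) ≡ ∑[ u < n ] ∑[ v < n ] f u v + ∑[ u < n ] ∑[ v < n ] g u v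
∑∑-distrib-+ {n} f g = trans (sum-cong-≗ (λ u → ∑-distrib-+ (f u) (g u)))
                             (∑-distrib-+ (λ u → ∑[ v < n ] f u v) (λ u → ∑[ v < n ] g u v))

∑-comm₃ : ∀ {k n} (f : Fin k → Fin n → Fin n → ℕ) →
          ∑[ i < k ] ∑[ u < n ] ∑[ v < n ] f i u v ≡ ∑[ u < n ] ∑[ v < n ] ∑[ i < k ] f i u v
∑-comm₃ {k} {n} f = trans (∑-comm (λ i u → ∑[ v < n ] f i u v)) (sum-cong-≗ (λ u → ∑-comm (λ i v → f i u v)))

sum-tabulate : ∀ {m} (f : Fin m → ℕ) → List.sum (tabulate f) ≡ ∑[ i < m ] f i
sum-tabulate {zero} f = refl
sum-tabulate {suc m} f = cong (f zero +_) (sum-tabulate (λ i → f (suc i)))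

sum-count : ∀ {n} (p : Fin n → Fin n → Bool) →
            List.sum (map (λ u → count (p u)) (allFin n)) ≡ ∑[ u < n ] ∑[ v < n ] [ p u v ]
sum-count {n} p = trans (sum-allFin (λ u → count (p u))) (sum-cong-≗ (λ u → sum-allFin (λ v → [ p u v ])))
  where
  sum-allFin : ∀ (f : Fin n → ℕ) → List.sum (map f (allFin n)) ≡ ∑[ i < n ] f i
  sum-allFin f = trans (cong List.sum (map-tabulate (λ i → i) f)) (sum-tabulate f)

-- Counting pairs

BoolRel : ℕ → Set
BoolRel n = Fin n → Fin n → Bool

pairCount : ∀ {n} → BoolRel n → ℕ
pairCount {n} R = ∑[ u < n ] ∑[ v < n ] [ R u v ∧ (toℕ u <ᵇ toℕ v) ]

numEdges≡pairCount : ∀ {n} (G : Graph n) → numEdges G ≡ pairCount (adj G)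
numEdges≡pairCount G = sum-count (λ u v → adj G u v ∧ (toℕ u <ᵇ toℕ v))

cut≡∑∑ : ∀ {n} (G : Graph n) (S : Subset n) →
         cut G S ≡ ∑[ u < n ] ∑[ v < n ] [ adj G u v ∧ (vlookup S u ∧ not (vlookup S v)) ]
cut≡∑∑ G S = sum-count (λ u v → adj G u v ∧ (vlookup S u ∧ not (vlookup S v)))

pairCount-cong-< : ∀ {n} {R Q : BoolRel n} → (∀ u v → toℕ u < toℕ v → R u v ≡ Q u v) → pairCount R ≡ pairCount Q
pairCount-cong-< {R = R} {Q} R≡Q = sum-cong-≗ (λ u → sum-cong-≗ (λ v → pointwise u v))
  where
  pointwise : ∀ u v → [ R u v ∧ (toℕ u <ᵇ toℕ v) ] ≡ [ Q u v ∧ (toℕ u <ᵇ toℕ v) ]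
  pointwise u v with toℕ u <ᵇ toℕ v in u<ᵇv
  ... | false = cong [_] (trans (∧-zeroʳ (R u v)) (sym (∧-zeroʳ (Q u v))))
  ... | true = cong (λ b → [ b ∧ true ]) (R≡Q u v (<ᵇ⇒< _ _ (Equivalence.from T-≡ u<ᵇv)))

pairCount-cong : ∀ {n} {R Q : BoolRel n} → (∀ u v → R u v ≡ Q u v) → pairCount R ≡ pairCount Q
pairCount-cong R≡Q = pairCount-cong-< (λ u v _ → R≡Q u v)

pairCount-mono : ∀ {n} {R Q : BoolRel n} → (∀ u v → R u v ≡ true → Q u v ≡ true) → pairCount R ≤ pairCount Q
pairCount-mono {R = R} {Q} R⇒Q = ∑-mono (λ u → ∑-mono (λ v → pointwise u v))
  where
  pointwise : ∀ u v → [ R u v ∧ (toℕ u <ᵇ toℕ v) ] ≤ [ Q u v ∧ (toℕ u <ᵇ toℕ v) ]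
  pointwise u v with R u v in Ruv
  ... | false = z≤n
  ... | true rewrite R⇒Q u v Ruv = ≤-refl

pairCount-split : ∀ {n} (R Q : BoolRel n) →
                  pairCount (λ u v → R u v ∧ not (Q u v)) + pairCount (λ u v → R u v ∧ Q u v) ≡ pairCount R
pairCount-split R Q = trans (sym (∑∑-distrib-+ (λ u v → [ (R u v ∧ not (Q u v)) ∧ (toℕ u <ᵇ toℕ v) ])
                                               (λ u v → [ (R u v ∧ Q u v) ∧ (toℕ u <ᵇ toℕ v) ])))
                            (sum-cong-≗ (λ u → sum-cong-≗ (λ v → pointwise (R u v) (Q u v) _)))
  where
  pointwise : ∀ r q l → [ (r ∧ not q) ∧ l ] + [ (r ∧ q) ∧ l ] ≡ [ r ∧ l ]
  pointwise false q l = refl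
  pointwise true false l = +-identityʳ _
  pointwise true true l = refl

pairCount-pos : ∀ {n} (R : BoolRel n) {u v} → R u v ≡ true → toℕ u < toℕ v → 0 < pairCount R
pairCount-pos {n} R {u} {v} Ruv u<v =
  ≤-trans (≤-reflexive (cong₂ (λ r l → [ r ∧ l ]) (sym Ruv) (sym (Equivalence.to T-≡ (<⇒<ᵇ u<v)))))
          (≤-trans (∑-term (λ v → [ R u v ∧ (toℕ u <ᵇ toℕ v) ]) v)
                   (∑-term (λ u → ∑[ v < n ] [ R u v ∧ (toℕ u <ᵇ toℕ v) ]) u))

pairCount-pos⇒∃ : ∀ {n} (R : BoolRel n) → 0 < pairCount R → ∃ λ u → ∃ λ v → R u v ≡ true × toℕ u < toℕ v
pairCount-pos⇒∃ {n} R 0<count with any? (λ u → any? (λ v → (R u v ∧ (toℕ u <ᵇ toℕ v)) Bool.≟ true))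
... | yes (u , v , related) = u , v , split (R u v) related
  where
  split : ∀ r → (r ∧ (toℕ u <ᵇ toℕ v)) ≡ true → r ≡ true × toℕ u < toℕ v
  split true u<ᵇv = refl , <ᵇ⇒< (toℕ u) (toℕ v) (Equivalence.from T-≡ u<ᵇv)
... | no unrelated = contradiction count≡0 (>⇒≢ 0<count)
  where
  no-pair : ∀ u v → [ R u v ∧ (toℕ u <ᵇ toℕ v) ] ≡ 0
  no-pair u v with R u v ∧ (toℕ u <ᵇ toℕ v) in related
  ... | true = contradiction (u , v , related) unrelated
  ... | false = refl
  count≡0 : pairCount R ≡ 0
  count≡0 = trans (sum-cong-≗ (λ u → trans (sum-cong-≗ (no-pair u)) (sum-replicate-zero n))) (sum-replicate-zero n)

∑∑≡2*pairCount : ∀ {n} (R : BoolRel n) → (∀ u v → R u v ≡ R v u) → (∀ u → R u u ≡ false) →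
                 ∑[ u < n ] ∑[ v < n ] [ R u v ] ≡ 2 * pairCount R
∑∑≡2*pairCount {n} R R-sym R-irrefl = begin
  ∑[ u < n ] ∑[ v < n ] [ R u v ]
    ≡⟨ sum-cong-≗ (λ u → sum-cong-≗ (λ v → split u v)) ⟩
  ∑[ u < n ] ∑[ v < n ] ([ R u v ∧ (toℕ u <ᵇ toℕ v) ] + [ R v u ∧ (toℕ v <ᵇ toℕ u) ])
    ≡⟨ ∑∑-distrib-+ (λ u v → [ R u v ∧ (toℕ u <ᵇ toℕ v) ]) (λ u v → [ R v u ∧ (toℕ v <ᵇ toℕ u) ]) ⟩
  pairCount R + ∑[ u < n ] ∑[ v < n ] [ R v u ∧ (toℕ v <ᵇ toℕ u) ]
    ≡⟨ cong (pairCount R +_) (∑-comm (λ u v → [ R v u ∧ (toℕ v <ᵇ toℕ u) ])) ⟩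
  pairCount R + pairCount R
    ≡⟨ cong (pairCount R +_) (sym (+-identityʳ (pairCount R))) ⟩
  2 * pairCount R ∎
  where
  open ≡-Reasoning
  split : ∀ u v → [ R u v ] ≡ [ R u v ∧ (toℕ u <ᵇ toℕ v) ] + [ R v u ∧ (toℕ v <ᵇ toℕ u) ]
  split u v rewrite sym (R-sym u v) with R u v in Ruv
  ... | false = refl
  ... | true = sym (<ᵇ-trichotomy (off-diagonal Ruv ∘ toℕ-injective))
    where
    off-diagonal : R u v ≡ true → u ≢ v
    off-diagonal Ruv refl = contradiction (trans (sym Ruv) (R-irrefl u)) λ ()

∣p∣≡∑ : ∀ {n} (S : Subset n) → ∣ S ∣ ≡ ∑[ v < n ] [ vlookup S v ]
∣p∣≡∑ [] = refl
∣p∣≡∑ (true ∷ S) = cong suc (∣p∣≡∑ S)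
∣p∣≡∑ (false ∷ S) = ∣p∣≡∑ S

[1+n]C2≡n+nC2 : ∀ m → suc m C 2 ≡ m + m C 2
[1+n]C2≡n+nC2 m = trans (sym (nCk+nC[k+1]≡[n+1]C[k+1] m 1)) (cong (_+ m C 2) (nC1≡n m))

pairCount-suc : ∀ {n} (R : BoolRel (suc n)) →
                pairCount R ≡ ∑[ v < n ] [ R zero (suc v) ] + pairCount (λ u v → R (suc u) (suc v))
pairCount-suc {n} R = cong₂ _+_
  (cong₂ _+_ (cong [_] (∧-zeroʳ (R zero zero))) (sum-cong-≗ (λ v → cong [_] (∧-identityʳ (R zero (suc v))))))
  (sum-cong-≗ (λ u → cong (_+ ∑[ v < n ] [ R (suc u) (suc v) ∧ (toℕ u <ᵇ toℕ v) ])
                          (cong [_] (∧-zeroʳ (R (suc u) zero)))))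

pairCount-subset : ∀ {n} (S : Subset n) → pairCount (λ u v → vlookup S u ∧ vlookup S v) ≡ ∣ S ∣ C 2
pairCount-subset [] = refl
pairCount-subset {suc n} (b ∷ S) =
  trans (pairCount-suc (λ u v → vlookup (b ∷ S) u ∧ vlookup (b ∷ S) v)) (by-head b)
  where
  by-head : ∀ b → ∑[ v < n ] [ b ∧ vlookup S v ] + pairCount (λ u v → vlookup S u ∧ vlookup S v) ≡ ∣ b ∷ S ∣ C 2
  by-head true = trans (cong₂ _+_ (sym (∣p∣≡∑ S)) (pairCount-subset S)) (sym ([1+n]C2≡n+nC2 ∣ S ∣))
  by-head false = trans (cong (_+ pairCount (λ u v → vlookup S u ∧ vlookup S v)) (sum-replicate-zero n))
                        (pairCount-subset S)

numEdges-mono : ∀ {n} {H G : Graph n} → H ⊆G G → numEdges H ≤ numEdges G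
numEdges-mono {H = H} {G} H⊆G = subst₂ _≤_ (sym (numEdges≡pairCount H)) (sym (numEdges≡pairCount G))
                                          (pairCount-mono {R = adj H} {Q = adj G} H⊆G)

crossing : ∀ {n} → Graph n → BoolRel n → ℕ
crossing G R = pairCount (λ u v → adj G u v ∧ not (R u v))

crossing-cong : ∀ {n} (G : Graph n) {R Q : BoolRel n} → (∀ u v → R u v ≡ Q u v) → crossing G R ≡ crossing G Q
crossing-cong G R≡Q = pairCount-cong (λ u v → cong (λ r → adj G u v ∧ not r) (R≡Q u v))

numEdges≤crossing+pairCount : ∀ {n} (G : Graph n) (R : BoolRel n) → numEdges G ≤ crossing G R + pairCount R
numEdges≤crossing+pairCount G R = begin
  numEdges G                                                   ≡⟨ numEdges≡pairCount G ⟩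
  pairCount (adj G)                                            ≡⟨ sym (pairCount-split (adj G) R) ⟩
  crossing G R + pairCount (λ u v → adj G u v ∧ R u v)         ≤⟨ +-monoʳ-≤ (crossing G R) (pairCount-mono G∧R⇒R) ⟩
  crossing G R + pairCount R                                   ∎
  where
  open ≤-Reasoning
  G∧R⇒R : ∀ u v → (adj G u v ∧ R u v) ≡ true → R u v ≡ true
  G∧R⇒R u v G∧R with adj G u v
  ... | true = G∧R

-- The cost of a clustering

module _ {n : ℕ} (Cl : Clustering n) where

  private
    k : ℕ
    k = length (proj₁ Cl)

  cluster : Fin k → Subset n
  cluster = lookup (proj₁ Cl)

  clusterOf : Fin n → Fin k
  clusterOf v = proj₁ (proj₂ (proj₂ (proj₂ Cl)) v)

  sameCluster : BoolRel n
  sameCluster u v = does (clusterOf u ≟ clusterOf v)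

  ∈-cluster-clusterOf : ∀ v → v ∈ˢ cluster (clusterOf v)
  ∈-cluster-clusterOf v = proj₂ (proj₂ (proj₂ (proj₂ Cl)) v)

  ∈-cluster⇒≡clusterOf : ∀ {i v} → v ∈ˢ cluster i → i ≡ clusterOf v
  ∈-cluster⇒≡clusterOf {i} {v} v∈i with i ≟ clusterOf v
  ... | yes i≡ = i≡
  ... | no i≢ = contradiction (subst (v ∈ˢ_) (proj₁ (proj₂ (proj₂ Cl)) i (clusterOf v) i≢)
                                      (x∈p∩q⁺ (v∈i , ∈-cluster-clusterOf v))) ∉⊥

  cluster-membership : ∀ i v → vlookup (cluster i) v ≡ does (i ≟ clusterOf v)
  cluster-membership i v with vlookup (cluster i) v in v∈i
  ... | true = sym (dec-true (i ≟ clusterOf v) (∈-cluster⇒≡clusterOf (lookup⇒[]= v (cluster i) v∈i)))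
  ... | false = sym (dec-false (i ≟ clusterOf v) λ { refl →
                  contradiction (trans (sym v∈i) ([]=⇒lookup (∈-cluster-clusterOf v))) λ () })

  ∑-clusters : ∀ (f : Bool → Bool) u v →
               ∑[ i < k ] [ vlookup (cluster i) u ∧ f (vlookup (cluster i) v) ] ≡ [ f (sameCluster u v) ]
  ∑-clusters f u v = trans
    (sum-cong-≗ (λ i → cong₂ (λ a b → [ a ∧ f b ]) (cluster-membership i u) (cluster-membership i v)))
    (∑-δ (clusterOf u) (λ i → f (does (i ≟ clusterOf v))))

  ∑-cut : ∀ (G : Graph n) → ∑[ i < k ] cut G (cluster i) ≡ 2 * crossing G sameCluster
  ∑-cut G = begin
    ∑[ i < k ] cut G (cluster i)
      ≡⟨ sum-cong-≗ (λ i → cut≡∑∑ G (cluster i)) ⟩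
    ∑[ i < k ] ∑[ u < n ] ∑[ v < n ] [ adj G u v ∧ (vlookup (cluster i) u ∧ not (vlookup (cluster i) v)) ]
      ≡⟨ ∑-comm₃ (λ i u v → [ adj G u v ∧ (vlookup (cluster i) u ∧ not (vlookup (cluster i) v)) ]) ⟩
    ∑[ u < n ] ∑[ v < n ] ∑[ i < k ] [ adj G u v ∧ (vlookup (cluster i) u ∧ not (vlookup (cluster i) v)) ]
      ≡⟨ sum-cong-≗ (λ u → sum-cong-≗ (λ v → trans
           (sum-cong-≗ (λ i → cong [_] (∧-swapˡ (adj G u v) (vlookup (cluster i) u) (not (vlookup (cluster i) v)))))
           (∑-clusters (λ s → adj G u v ∧ not s) u v))) ⟩
    ∑[ u < n ] ∑[ v < n ] [ adj G u v ∧ not (sameCluster u v) ]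
      ≡⟨ ∑∑≡2*pairCount (λ u v → adj G u v ∧ not (sameCluster u v))
           (λ u v → cong₂ (λ a s → a ∧ not s) (Graph.sym G u v) (does-sym _≟_ (clusterOf u) (clusterOf v)))
           (λ u → cong (_∧ not (sameCluster u u)) (Graph.irrefl G u)) ⟩
    2 * crossing G sameCluster ∎
    where open ≡-Reasoning

  ∑-C2 : ∑[ i < k ] (∣ cluster i ∣ C 2) ≡ pairCount sameCluster
  ∑-C2 = begin
    ∑[ i < k ] (∣ cluster i ∣ C 2)
      ≡⟨ sum-cong-≗ (λ i → sym (pairCount-subset (cluster i))) ⟩
    ∑[ i < k ] ∑[ u < n ] ∑[ v < n ] [ (vlookup (cluster i) u ∧ vlookup (cluster i) v) ∧ (toℕ u <ᵇ toℕ v) ]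
      ≡⟨ ∑-comm₃ (λ i u v → [ (vlookup (cluster i) u ∧ vlookup (cluster i) v) ∧ (toℕ u <ᵇ toℕ v) ]) ⟩
    ∑[ u < n ] ∑[ v < n ] ∑[ i < k ] [ (vlookup (cluster i) u ∧ vlookup (cluster i) v) ∧ (toℕ u <ᵇ toℕ v) ]
      ≡⟨ sum-cong-≗ (λ u → sum-cong-≗ (λ v → trans
           (sum-cong-≗ (λ i → cong [_] (∧-assoc (vlookup (cluster i) u) (vlookup (cluster i) v) (toℕ u <ᵇ toℕ v))))
           (∑-clusters (λ s → s ∧ (toℕ u <ᵇ toℕ v)) u v))) ⟩
    pairCount sameCluster ∎
    where open ≡-Reasoning

toℚ≡mkℚ : ∀ k → toℚ k ≡ mkℚ (ℤ.+ k) 0 (Coprimality.sym (Coprimality.1-coprimeTo k))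
toℚ≡mkℚ k = ℚₚ.normalize-coprime (Coprimality.sym (Coprimality.1-coprimeTo k))

toℚ-+ : ∀ a b → toℚ (a + b) ≡ toℚ a +ℚ toℚ b
toℚ-+ a b = sym (begin
  toℚ a +ℚ toℚ b                              ≡⟨ cong₂ _+ℚ_ (toℚ≡mkℚ a) (toℚ≡mkℚ b) ⟩
  (ℤ.+ a ℤ.* ℤ.+ 1 ℤ.+ ℤ.+ b ℤ.* ℤ.+ 1) / 1
    ≡⟨ cong (_/ 1) (trans (cong₂ ℤ._+_ (ℤ.*-identityʳ (ℤ.+ a)) (ℤ.*-identityʳ (ℤ.+ b))) (sym (ℤ.pos-+ a b))) ⟩
  toℚ (a + b)                                 ∎)
  where open ≡-Reasoning

toℚ-mono-≤ : ∀ {a b} → a ≤ b → toℚ a ≤ℚ toℚ b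
toℚ-mono-≤ {a} {b} a≤b rewrite toℚ≡mkℚ a | toℚ≡mkℚ b = *≤* (ℤ.*-monoʳ-≤-nonNeg (ℤ.+ 1) (ℤ.+≤+ a≤b))

½*toℚ[2*x] : ∀ x → ½ *ℚ toℚ (2 * x) ≡ toℚ x
½*toℚ[2*x] x = begin
  ½ *ℚ toℚ (x + (x + 0))      ≡⟨ cong (λ y → ½ *ℚ toℚ (x + y)) (+-identityʳ x) ⟩
  ½ *ℚ toℚ (x + x)            ≡⟨ cong (½ *ℚ_) (toℚ-+ x x) ⟩
  ½ *ℚ (toℚ x +ℚ toℚ x)       ≡⟨ ℚₚ.*-distribˡ-+ ½ (toℚ x) (toℚ x) ⟩
  ½ *ℚ toℚ x +ℚ ½ *ℚ toℚ x    ≡⟨ sym (ℚₚ.*-distribʳ-+ (toℚ x) ½ ½) ⟩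
  1ℚ *ℚ toℚ x                 ≡⟨ ℚₚ.*-identityˡ (toℚ x) ⟩
  toℚ x                       ∎
  where open ≡-Reasoning

+-interchange-*ℚ : ∀ h l a b c d →
                   (h *ℚ a +ℚ l *ℚ b) +ℚ (h *ℚ c +ℚ l *ℚ d) ≡ h *ℚ (a +ℚ c) +ℚ l *ℚ (b +ℚ d)
+-interchange-*ℚ = solve 6 (λ h l a b c d → (h :* a :+ l :* b) :+ (h :* c :+ l :* d) := h :* (a :+ c) :+ l :* (b :+ d)) refl
  where open +-*-Solver

lamPrimeList≡∑ : ∀ {n} (G : Graph n) (cs : List (Subset n)) lam →
                 lamPrimeList G cs lam ≡ ½ *ℚ toℚ (∑[ i < length cs ] cut G (lookup cs i))
                                         +ℚ lam *ℚ toℚ (∑[ i < length cs ] (∣ lookup cs i ∣ C 2))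
lamPrimeList≡∑ G [] lam = sym (trans (cong₂ _+ℚ_ (ℚₚ.*-zeroʳ ½) (ℚₚ.*-zeroʳ lam)) (ℚₚ.+-identityʳ 0ℚ))
lamPrimeList≡∑ G (S ∷ cs) lam = begin
  (½ *ℚ toℚ (cut G S) +ℚ lam *ℚ toℚ (∣ S ∣ C 2)) +ℚ lamPrimeList G cs lam
    ≡⟨ cong ((½ *ℚ toℚ (cut G S) +ℚ lam *ℚ toℚ (∣ S ∣ C 2)) +ℚ_) (lamPrimeList≡∑ G cs lam) ⟩
  (½ *ℚ toℚ (cut G S) +ℚ lam *ℚ toℚ (∣ S ∣ C 2)) +ℚ (½ *ℚ toℚ cuts +ℚ lam *ℚ toℚ sizes)
    ≡⟨ +-interchange-*ℚ ½ lam (toℚ (cut G S)) (toℚ (∣ S ∣ C 2)) (toℚ cuts) (toℚ sizes) ⟩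
  ½ *ℚ (toℚ (cut G S) +ℚ toℚ cuts) +ℚ lam *ℚ (toℚ (∣ S ∣ C 2) +ℚ toℚ sizes)
    ≡⟨ sym (cong₂ (λ a b → ½ *ℚ a +ℚ lam *ℚ b) (toℚ-+ (cut G S) cuts) (toℚ-+ (∣ S ∣ C 2) sizes)) ⟩
  ½ *ℚ toℚ (cut G S + cuts) +ℚ lam *ℚ toℚ (∣ S ∣ C 2 + sizes) ∎
  where
  open ≡-Reasoning
  cuts sizes : ℕ
  cuts = ∑[ i < length cs ] cut G (lookup cs i)
  sizes = ∑[ i < length cs ] (∣ lookup cs i ∣ C 2)

cost : ∀ {n} → Graph n → ℚ → BoolRel n → ℚ
cost G lam R = toℚ (crossing G R) +ℚ lam *ℚ toℚ (pairCount R)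

LamPrime≡cost : ∀ {n} (G : Graph n) (Cl : Clustering n) lam → LamPrime G Cl lam ≡ cost G lam (sameCluster Cl)
LamPrime≡cost G Cl lam = trans (lamPrimeList≡∑ G (proj₁ Cl) lam)
  (cong₂ (λ a b → a +ℚ lam *ℚ toℚ b)
         (trans (cong (λ z → ½ *ℚ toℚ z) (∑-cut Cl G)) (½*toℚ[2*x] (crossing G (sameCluster Cl))))
         (∑-C2 Cl))

affine-split : ∀ lam t b → t +ℚ lam *ℚ b ≡ (1ℚ -ℚ lam) *ℚ t +ℚ lam *ℚ (t +ℚ b)
affine-split = solve 3 (λ l t b → t :+ l :* b := (con 1ℚ :- l) :* t :+ l :* (t :+ b)) refl
  where open +-*-Solver

affine-mono : ∀ {lam} → 0ℚ ≤ℚ lam → lam ≤ℚ 1ℚ → ∀ {x′ b′ x b} → x′ ≤ x → x′ + b′ ≤ x + b →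
              toℚ x′ +ℚ lam *ℚ toℚ b′ ≤ℚ toℚ x +ℚ lam *ℚ toℚ b
affine-mono {lam} 0≤lam lam≤1 {x′} {b′} {x} {b} x′≤x x′+b′≤x+b = begin
  toℚ x′ +ℚ lam *ℚ toℚ b′                   ≡⟨ affine-split lam (toℚ x′) (toℚ b′) ⟩
  μ *ℚ toℚ x′ +ℚ lam *ℚ (toℚ x′ +ℚ toℚ b′)  ≡⟨ cong (λ y → μ *ℚ toℚ x′ +ℚ lam *ℚ y) (sym (toℚ-+ x′ b′)) ⟩
  μ *ℚ toℚ x′ +ℚ lam *ℚ toℚ (x′ + b′)       ≤⟨ ℚₚ.+-mono-≤ (ℚₚ.*-monoˡ-≤-nonNeg μ (toℚ-mono-≤ x′≤x))
                                                          (ℚₚ.*-monoˡ-≤-nonNeg lam (toℚ-mono-≤ x′+b′≤x+b)) ⟩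
  μ *ℚ toℚ x +ℚ lam *ℚ toℚ (x + b)          ≡⟨ cong (λ y → μ *ℚ toℚ x +ℚ lam *ℚ y) (toℚ-+ x b) ⟩
  μ *ℚ toℚ x +ℚ lam *ℚ (toℚ x +ℚ toℚ b)     ≡⟨ sym (affine-split lam (toℚ x) (toℚ b)) ⟩
  toℚ x +ℚ lam *ℚ toℚ b                     ∎
  where
  open ℚₚ.≤-Reasoning
  μ : ℚ
  μ = 1ℚ -ℚ lam
  instance
    lam-nonNeg : NonNegative lam
    lam-nonNeg = nonNegative 0≤lam
    μ-nonNeg : NonNegative μ
    μ-nonNeg = nonNegative (subst (_≤ℚ μ) (ℚₚ.+-inverseʳ lam) (ℚₚ.+-monoˡ-≤ (- lam) lam≤1))

_≼[_]_ : ∀ {n} → BoolRel n → Graph n → BoolRel n → Set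
R ≼[ G ] Q = crossing G R ≤ crossing G Q × crossing G R + pairCount R ≤ crossing G Q + pairCount Q

≼-trans : ∀ {n} {G : Graph n} {R Q S} → R ≼[ G ] Q → Q ≼[ G ] S → R ≼[ G ] S
≼-trans (x≤ , s≤) (x≤′ , s≤′) = ≤-trans x≤ x≤′ , ≤-trans s≤ s≤′

cost-mono : ∀ {n} (G : Graph n) {lam} → 0ℚ ≤ℚ lam → lam ≤ℚ 1ℚ →
            ∀ {R Q} → R ≼[ G ] Q → cost G lam R ≤ℚ cost G lam Q
cost-mono G 0≤lam lam≤1 (x≤ , s≤) = affine-mono 0≤lam lam≤1 x≤ s≤

-- Clusterings from labelings

IsBoolEquivalence : ∀ {n} → BoolRel n → Set
IsBoolEquivalence R = IsEquivalence (λ u v → R u v ≡ true)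

AllPairs⇒lookup : ∀ {A : Set} {R : A → A → Set} → (∀ {x y} → R x y → R y x) →
                  ∀ {xs} → AllPairs R xs → ∀ i j → i ≢ j → R (lookup xs i) (lookup xs j)
AllPairs⇒lookup R-sym (_ ∷ _) zero zero i≢j = contradiction refl i≢j
AllPairs⇒lookup R-sym (x∼xs ∷ _) zero (suc j) _ = All.lookup x∼xs (∈-lookup j)
AllPairs⇒lookup R-sym (x∼xs ∷ _) (suc i) zero _ = R-sym (All.lookup x∼xs (∈-lookup i))
AllPairs⇒lookup R-sym (_ ∷ xs!) (suc i) (suc j) i≢j = AllPairs⇒lookup R-sym xs! i j (i≢j ∘ cong suc)

module _ {L : Set} (_≟ᴸ_ : DecidableEquality L) {n : ℕ} (κ : Fin n → L) where

  kernel : BoolRel n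
  kernel u v = does (κ u ≟ᴸ κ v)

  kernel-isBoolEquivalence : IsBoolEquivalence kernel
  kernel-isBoolEquivalence = record
    { refl = dec-true (κ _ ≟ᴸ κ _) refl
    ; sym = λ uv → dec-true (κ _ ≟ᴸ κ _) (sym (≡-from uv))
    ; trans = λ uv vw → dec-true (κ _ ≟ᴸ κ _) (trans (≡-from uv) (≡-from vw))
    }
    where
    ≡-from : ∀ {u v} → kernel u v ≡ true → κ u ≡ κ v
    ≡-from {u} {v} = does⇒witness (κ u ≟ᴸ κ v)

  fiber : L → Subset n
  fiber ℓ = Vec.tabulate (λ u → does (κ u ≟ᴸ ℓ))

  ∈-fiber⁺ : ∀ {u ℓ} → κ u ≡ ℓ → u ∈ˢ fiber ℓ
  ∈-fiber⁺ {u} {ℓ} κu≡ℓ = lookup⇒[]= u (fiber ℓ) (trans (lookup∘tabulate _ u) (dec-true (κ u ≟ᴸ ℓ) κu≡ℓ))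

  ∈-fiber⁻ : ∀ {u ℓ} → u ∈ˢ fiber ℓ → κ u ≡ ℓ
  ∈-fiber⁻ {u} {ℓ} u∈ with κ u ≟ᴸ ℓ in κu≟ℓ
  ... | yes κu≡ℓ = κu≡ℓ
  ... | no _ = contradiction (trans (sym ([]=⇒lookup u∈)) (trans (lookup∘tabulate _ u) (cong does κu≟ℓ))) λ ()

  fibers-disjoint : ∀ {ℓ ℓ′} → ℓ ≢ ℓ′ → fiber ℓ ∩ fiber ℓ′ ≡ ∅
  fibers-disjoint ℓ≢ℓ′ = Empty-unique λ (u , u∈∩) →
    let u∈ℓ , u∈ℓ′ = x∈p∩q⁻ _ _ u∈∩ in ℓ≢ℓ′ (trans (sym (∈-fiber⁻ u∈ℓ)) (∈-fiber⁻ u∈ℓ′))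

  labels : List L
  labels = deduplicate _≟ᴸ_ (map κ (allFin n))

  fibers : List (Subset n)
  fibers = map fiber labels

  fibers-isClustering : IsClustering fibers
  fibers-isClustering = nonempty , disjoint , covers
    where
    nonempty : All Nonempty fibers
    nonempty = All.map⁺ (All.tabulate λ ℓ∈ →
      let u , _ , ℓ≡κu = ∈-map⁻ κ (∈-deduplicate⁻ _≟ᴸ_ (map κ (allFin n)) ℓ∈) in u , ∈-fiber⁺ (sym ℓ≡κu))
    disjoint : ∀ i j → i ≢ j → lookup fibers i ∩ lookup fibers j ≡ ∅
    disjoint = AllPairs⇒lookup (λ {S} {T} S∩T≡∅ → trans (∩-comm T S) S∩T≡∅)
                 (AllPairs.map⁺ (AllPairs.map fibers-disjoint (deduplicate-! _≟ᴸ_ (map κ (allFin n)))))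
    covers : ∀ v → ∃ λ i → v ∈ˢ lookup fibers i
    covers v = let fiber∈ = ∈-map⁺ fiber (∈-deduplicate⁺ _≟ᴸ_ (∈-map⁺ κ (∈-allFin v)))
               in Any.index fiber∈ , subst (v ∈ˢ_) (lookup-index fiber∈) (∈-fiber⁺ refl)

  partitionBy : Clustering n
  partitionBy = fibers , fibers-isClustering

  private
    cluster-is-fiber : ∀ i → ∃ λ ℓ → cluster partitionBy i ≡ fiber ℓ
    cluster-is-fiber i = All.lookup {P = λ S → ∃ λ ℓ → S ≡ fiber ℓ}
                                    (All.map⁺ (All.universal (λ ℓ → ℓ , refl) labels)) (∈-lookup i)

    cluster-clusterOf : ∀ u → cluster partitionBy (clusterOf partitionBy u) ≡ fiber (κ u)
    cluster-clusterOf u =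
      let _ , ≡fiber = cluster-is-fiber (clusterOf partitionBy u)
      in trans ≡fiber (cong fiber (sym (∈-fiber⁻ (subst (u ∈ˢ_) ≡fiber (∈-cluster-clusterOf partitionBy u)))))

  sameCluster-partitionBy : ∀ u v → sameCluster partitionBy u v ≡ kernel u v
  sameCluster-partitionBy u v =
    does-⇔ (mk⇔ same⇒ ⇒same) (clusterOf partitionBy u ≟ clusterOf partitionBy v) (κ u ≟ᴸ κ v)
    where
    same⇒ : clusterOf partitionBy u ≡ clusterOf partitionBy v → κ u ≡ κ v
    same⇒ ≡clusterOf = sym (∈-fiber⁻ (subst (v ∈ˢ_)
      (trans (cong (cluster partitionBy) (sym ≡clusterOf)) (cluster-clusterOf u)) (∈-cluster-clusterOf partitionBy v)))
    ⇒same : κ u ≡ κ v → clusterOf partitionBy u ≡ clusterOf partitionBy v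
    ⇒same κu≡κv = ∈-cluster⇒≡clusterOf partitionBy (subst (v ∈ˢ_) (sym (cluster-clusterOf u)) (∈-fiber⁺ (sym κu≡κv)))

-- Row u of a matrix is the set of vertices clustered with u, so a partition of
-- Fin n is recorded by a matrix and recovered by grouping equal rows; this makes
-- the partitions of Fin n a finite, enumerable type.
Matrix : ℕ → Set
Matrix n = Vec (Subset n) n

rowKernel : ∀ {n} → Matrix n → BoolRel n
rowKernel M = kernel (≡-dec Bool._≟_) (Vec.lookup M)

matrixOf : ∀ {n} → BoolRel n → Matrix n
matrixOf R = Vec.tabulate (λ u → Vec.tabulate (R u))

rowKernel-matrixOf : ∀ {n} {R : BoolRel n} → IsBoolEquivalence R → ∀ u v → rowKernel (matrixOf R) u v ≡ R u v
rowKernel-matrixOf {n} {R} R-equiv u v = ⇔→≡ (mk⇔ rows≡⇒R R⇒rows≡)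
  where
  module E = IsEquivalence R-equiv
  row : Fin n → Subset n
  row = Vec.lookup (matrixOf R)
  row≡ : ∀ w → row w ≡ Vec.tabulate (R w)
  row≡ w = lookup∘tabulate (λ w → Vec.tabulate (R w)) w
  entry : ∀ w → Vec.lookup (row w) v ≡ R w v
  entry w = trans (cong (λ r → Vec.lookup r v) (row≡ w)) (lookup∘tabulate (R w) v)
  rows≡⇒R : rowKernel (matrixOf R) u v ≡ true → R u v ≡ true
  rows≡⇒R k = let rows≡ = does⇒witness (≡-dec Bool._≟_ (row u) (row v)) k
              in trans (sym (entry u)) (trans (cong (λ r → Vec.lookup r v) rows≡) (trans (entry v) E.refl))
  R⇒rows≡ : R u v ≡ true → rowKernel (matrixOf R) u v ≡ true
  R⇒rows≡ Ruv = dec-true (≡-dec Bool._≟_ (row u) (row v))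
                         (trans (row≡ u) (trans (tabulate-cong same-row) (sym (row≡ v))))
    where
    same-row : ∀ w → R u w ≡ R v w
    same-row w = ⇔→≡ (mk⇔ (λ Ruw → E.trans (E.sym Ruv) Ruw) (λ Rvw → E.trans Ruv Rvw))

vectors : ∀ {A : Set} n → List A → List (Vec A n)
vectors zero xs = [] ∷ []
vectors (suc n) xs = cartesianProductWith _∷_ xs (vectors n xs)

∈-vectors : ∀ {A : Set} {xs : List A} → (∀ a → a ∈ xs) → ∀ {n} (v : Vec A n) → v ∈ vectors n xs
∈-vectors all∈ [] = here refl
∈-vectors all∈ (a ∷ v) = ∈-cartesianProductWith⁺ _∷_ (all∈ a) (∈-vectors all∈ v)

matrices : ∀ n → List (Matrix n)
matrices n = vectors n (vectors n (true ∷ false ∷ []))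

∈-matrices : ∀ {n} (M : Matrix n) → M ∈ matrices n
∈-matrices = ∈-vectors (∈-vectors λ { true → here refl ; false → there (here refl) })

-- Cluster graphs

module _ {n : ℕ} (H : Graph n) where

  equalOrAdjacent : BoolRel n
  equalOrAdjacent u v = does (u ≟ v) ∨ adj H u v

  equalOrAdjacent⁺ : ∀ {u v} → u ≡ v ⊎ adj H u v ≡ true → equalOrAdjacent u v ≡ true
  equalOrAdjacent⁺ {u} (inj₁ refl) = cong (_∨ adj H u u) (dec-true (u ≟ u) refl)
  equalOrAdjacent⁺ {u} {v} (inj₂ uv) = trans (cong (does (u ≟ v) ∨_) uv) (∨-zeroʳ (does (u ≟ v)))

  equalOrAdjacent⁻ : ∀ {u v} → equalOrAdjacent u v ≡ true → u ≡ v ⊎ adj H u v ≡ true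
  equalOrAdjacent⁻ {u} {v} uv with u ≟ v
  ... | yes u≡v = inj₁ u≡v
  ... | no _ = inj₂ uv

  equalOrAdjacent-isBoolEquivalence : AllComponentsCliques H → IsBoolEquivalence equalOrAdjacent
  equalOrAdjacent-isBoolEquivalence cliques = record
    { refl = equalOrAdjacent⁺ (inj₁ refl)
    ; sym = λ {u} {v} uv → equalOrAdjacent⁺ (Sum.map sym (trans (Graph.sym H v u)) (equalOrAdjacent⁻ uv))
    ; trans = λ uv vw → equalOrAdjacent⁺ (transitive (equalOrAdjacent⁻ uv) (equalOrAdjacent⁻ vw))
    }
    where
    transitive : ∀ {u v w} → u ≡ v ⊎ adj H u v ≡ true → v ≡ w ⊎ adj H v w ≡ true → u ≡ w ⊎ adj H u w ≡ true
    transitive (inj₁ refl) vw = vw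
    transitive (inj₂ uv) (inj₁ refl) = inj₂ uv
    transitive {u} {v} {w} (inj₂ uv) (inj₂ vw) with u ≟ w
    ... | yes u≡w = inj₁ u≡w
    ... | no u≢w = inj₂ (cliques u w (step uv (step vw here)) u≢w)

  equalOrAdjacent-< : ∀ {u v} → toℕ u < toℕ v → equalOrAdjacent u v ≡ adj H u v
  equalOrAdjacent-< {u} {v} u<v = cong (_∨ adj H u v) (dec-false (u ≟ v) λ { refl → <-irrefl refl u<v })

  pairCount-equalOrAdjacent : pairCount equalOrAdjacent ≡ numEdges H
  pairCount-equalOrAdjacent = trans (pairCount-cong-< (λ u v → equalOrAdjacent-<)) (sym (numEdges≡pairCount H))

  crossing+pairCount-equalOrAdjacent : ∀ {G} → H ⊆G G →
                                       crossing G equalOrAdjacent + pairCount equalOrAdjacent ≡ numEdges G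
  crossing+pairCount-equalOrAdjacent {G} H⊆G = begin
    crossing G equalOrAdjacent + pairCount equalOrAdjacent
      ≡⟨ cong₂ _+_ (pairCount-cong-< λ u v u<v → cong (λ h → adj G u v ∧ not h) (equalOrAdjacent-< u<v))
                   (trans pairCount-equalOrAdjacent (numEdges≡pairCount H)) ⟩
    pairCount (λ u v → adj G u v ∧ not (adj H u v)) + pairCount (adj H)
      ≡⟨ cong (pairCount (λ u v → adj G u v ∧ not (adj H u v)) +_) (pairCount-cong H≡G∧H) ⟩
    pairCount (λ u v → adj G u v ∧ not (adj H u v)) + pairCount (λ u v → adj G u v ∧ adj H u v)
      ≡⟨ pairCount-split (adj G) (adj H) ⟩
    pairCount (adj G)
      ≡⟨ sym (numEdges≡pairCount G) ⟩
    numEdges G ∎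
    where
    open ≡-Reasoning
    H≡G∧H : ∀ u v → adj H u v ≡ (adj G u v ∧ adj H u v)
    H≡G∧H u v with adj H u v in Huv
    ... | true = sym (cong (_∧ true) (H⊆G u v Huv))
    ... | false = sym (∧-zeroʳ (adj G u v))

module _ {L : Set} (_≟ᴸ_ : DecidableEquality L) {n : ℕ} (κ : Fin n → L) where

  clusterGraph : Graph n
  clusterGraph = record
    { adj = λ u v → kernel _≟ᴸ_ κ u v ∧ not (does (u ≟ v))
    ; sym = λ u v → cong₂ (λ k d → k ∧ not d) (does-sym _≟ᴸ_ (κ u) (κ v)) (does-sym _≟_ u v)
    ; irrefl = λ u → trans (cong (λ d → kernel _≟ᴸ_ κ u u ∧ not d) (dec-true (u ≟ u) refl)) (∧-zeroʳ _)
    }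

  clusterGraph-adj⁺ : ∀ {u v} → κ u ≡ κ v → u ≢ v → adj clusterGraph u v ≡ true
  clusterGraph-adj⁺ {u} {v} κu≡κv u≢v =
    cong₂ (λ k d → k ∧ not d) (dec-true (κ u ≟ᴸ κ v) κu≡κv) (dec-false (u ≟ v) u≢v)

  clusterGraph-adj⁻ : ∀ {u v} → adj clusterGraph u v ≡ true → κ u ≡ κ v × u ≢ v
  clusterGraph-adj⁻ {u} {v} uv with κ u ≟ᴸ κ v | u ≟ v
  ... | yes κu≡κv | no u≢v = κu≡κv , u≢v

  clusterGraph-cliques : AllComponentsCliques clusterGraph
  clusterGraph-cliques u v u∼v u≢v = clusterGraph-adj⁺ (reach⇒≡ u∼v) u≢v
    where
    reach⇒≡ : ∀ {u v} → Reach clusterGraph u v → κ u ≡ κ v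
    reach⇒≡ here = refl
    reach⇒≡ (step uv vw) = trans (proj₁ (clusterGraph-adj⁻ uv)) (reach⇒≡ vw)

merge : ∀ {n} → Fin n → Fin n → Fin n → Fin n
merge a b u = if does (u ≟ b) then a else u

module _ {n : ℕ} (G : Graph n) {a b : Fin n} (ab : adj G a b ≡ true) where

  singleEdgeGraph : Graph n
  singleEdgeGraph = clusterGraph _≟_ (merge a b)

  singleEdgeGraph⊆G : singleEdgeGraph ⊆G G
  singleEdgeGraph⊆G u v uv = edge (clusterGraph-adj⁻ _≟_ (merge a b) uv)
    where
    edge : merge a b u ≡ merge a b v × u ≢ v → adj G u v ≡ true
    edge (merged , u≢v) with u ≟ b | v ≟ b
    ... | yes refl | yes refl = contradiction refl u≢v
    ... | yes refl | no _ rewrite sym merged = trans (Graph.sym G b a) ab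
    ... | no _ | yes refl rewrite merged = ab
    ... | no _ | no _ = contradiction merged u≢v

  singleEdgeGraph-ab : adj singleEdgeGraph a b ≡ true
  singleEdgeGraph-ab = clusterGraph-adj⁺ _≟_ (merge a b) (trans merge-a (sym merge-b)) a≢b
    where
    a≢b : a ≢ b
    a≢b refl = contradiction (trans (sym ab) (Graph.irrefl G a)) λ ()
    merge-a : merge a b a ≡ a
    merge-a with does (a ≟ b)
    ... | true = refl
    ... | false = refl
    merge-b : merge a b b ≡ a
    merge-b rewrite dec-true (b ≟ b) refl = refl

clusterDeletionValue<numEdges : ∀ {n} (G : Graph n) {c} →
                                IsClusterDeletionValue G c → 0 < numEdges G → c < numEdges G
clusterDeletionValue<numEdges {n} G (_ , minimal) 0<|E|
  with a , b , ab , a<b ← pairCount-pos⇒∃ (adj G) (subst (0 <_) (numEdges≡pairCount G) 0<|E|) =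
  ≤-trans (s≤s (minimal H (singleEdgeGraph⊆G G ab) (clusterGraph-cliques _≟_ (merge a b))))
          (∸-monoʳ-< 0<|H| (numEdges-mono {H = H} {G} (singleEdgeGraph⊆G G ab)))
  where
  H : Graph n
  H = singleEdgeGraph G ab
  0<|H| : 0 < numEdges H
  0<|H| = subst (0 <_) (sym (numEdges≡pairCount H)) (pairCount-pos (adj H) (singleEdgeGraph-ab G ab) a<b)

-- The family of clusterings

module _ {A : Set} {P : A → Set} (P? : Decidable P) (f : A → ℕ) where

  argminWhere : A → List A → A
  argminWhere d xs with filter P? xs
  ... | [] = d
  ... | y ∷ ys = argmin f y ys

  argminWhere-minimal : ∀ d {xs y} → y ∈ xs → P y → P (argminWhere d xs) × f (argminWhere d xs) ≤ f y
  argminWhere-minimal d {xs} {y} y∈xs Py with filter P? xs | ∈-filter⁺ P? y∈xs Py | All.all-filter P? xs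
  ... | z ∷ zs | y∈ | Pz All.∷ Pzs = argmin-all f Pz Pzs , minimal y∈
    where
    minimal : y ∈ z ∷ zs → f (argmin f z zs) ≤ f y
    minimal (here refl) = f[argmin]≤f[⊤] {f = f} z zs
    minimal (there y∈zs) = All.lookup (f[argmin]≤f[xs] {f = f} z zs) y∈zs

dominated⇒minimum∈ : ∀ {A : Set} (f : A → ℚ) {x xs} → x ∈ xs → (∀ d → ∃ λ m → m ∈ xs × f m ≤ℚ f d) →
                     ∃ λ m → m ∈ xs × ∀ d → f m ≤ℚ f d
dominated⇒minimum∈ {A} f {x} {xs} x∈xs dominated = m , m∈xs , m≤
  where
  m : A
  m = ℚExtrema.argmin f x xs
  m∈xs : m ∈ xs
  m∈xs = Sum.[ (λ m≡x → subst (_∈ xs) (sym m≡x) x∈xs) , (λ m∈ → m∈) ]′ (ℚExtrema.argmin-sel f x xs)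
  m≤ : ∀ d → f m ≤ℚ f d
  m≤ d with m′ , m′∈xs , m′≤d ← dominated d =
    ℚₚ.≤-trans (All.lookup (ℚExtrema.f[argmin]≤f[xs] x xs) m′∈xs) m′≤d

module _ {n : ℕ} (G : Graph n) where

  hasCrossing? : ∀ x → Decidable (λ M → crossing G (rowKernel M) ≡ x)
  hasCrossing? x M = crossing G (rowKernel M) ℕ.≟ x

  innerPairs : Matrix n → ℕ
  innerPairs M = pairCount (rowKernel M)

  -- For an x cut by no partition the default matrix is returned; such entries are never used.
  bestMatrix : ℕ → Matrix n
  bestMatrix x = argminWhere (hasCrossing? x) innerPairs (matrixOf (λ _ _ → true)) (matrices n)

  bestMatrix-≼ : ∀ {R} → IsBoolEquivalence R → rowKernel (bestMatrix (crossing G R)) ≼[ G ] R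
  bestMatrix-≼ {R} R-equiv
    with crossing≡ , pairCount≤ ← argminWhere-minimal (hasCrossing? (crossing G R)) innerPairs (matrixOf (λ _ _ → true))
                                    (∈-matrices (matrixOf R)) (crossing-cong G (rowKernel-matrixOf R-equiv)) =
    ≤-reflexive crossing≡ ,
    +-mono-≤ (≤-reflexive crossing≡) (≤-trans pairCount≤ (≤-reflexive (pairCount-cong (rowKernel-matrixOf R-equiv))))

  bestClustering : ℕ → Clustering n
  bestClustering x = partitionBy (≡-dec Bool._≟_) (Vec.lookup (bestMatrix x))

  LamPrime-bestClustering : ∀ x lam →
                            LamPrime G (bestClustering x) lam ≡ cost G lam (rowKernel (bestMatrix x))
  LamPrime-bestClustering x lam = trans (LamPrime≡cost G (bestClustering x) lam)
    (cong₂ (λ a b → toℚ a +ℚ lam *ℚ toℚ b) (crossing-cong G same) (pairCount-cong same))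
    where
    same : ∀ u v → sameCluster (bestClustering x) u v ≡ rowKernel (bestMatrix x) u v
    same = sameCluster-partitionBy (≡-dec Bool._≟_) (Vec.lookup (bestMatrix x))

  family : ℕ → List (Clustering n)
  family c = map bestClustering (upTo (suc c))

  length-family : ∀ c → length (family c) ≡ suc c
  length-family c = trans (length-map bestClustering (upTo (suc c))) (length-upTo (suc c))

  bestClustering∈family : ∀ {x c} → x ≤ c → bestClustering x ∈ family c
  bestClustering∈family x≤c = ∈-map⁺ bestClustering (∈-upTo⁺ (s≤s x≤c))

  clusterDeletion-partition : ∀ {c} → IsClusterDeletionValue G c →
                              ∃ λ K → IsBoolEquivalence K × crossing G K ≡ c
                                      × crossing G K + pairCount K ≡ numEdges G
  clusterDeletion-partition {c} ((H , H⊆G , cliques , |E|∸|H|≡c) , _) =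
    K , equalOrAdjacent-isBoolEquivalence H cliques , crossing≡c , crossing+pairCount≡
    where
    K : BoolRel n
    K = equalOrAdjacent H
    crossing+pairCount≡ : crossing G K + pairCount K ≡ numEdges G
    crossing+pairCount≡ = crossing+pairCount-equalOrAdjacent H {G} H⊆G
    crossing≡c : crossing G K ≡ c
    crossing≡c = begin
      crossing G K                               ≡⟨ sym (m+n∸n≡m (crossing G K) (numEdges H)) ⟩
      crossing G K + numEdges H ∸ numEdges H     ≡⟨ cong (λ p → crossing G K + p ∸ numEdges H)
                                                         (sym (pairCount-equalOrAdjacent H)) ⟩
      crossing G K + pairCount K ∸ numEdges H    ≡⟨ cong (_∸ numEdges H) crossing+pairCount≡ ⟩
      numEdges G ∸ numEdges H                    ≡⟨ |E|∸|H|≡c ⟩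
      c                                          ∎
      where open ≡-Reasoning

  family-≼ : ∀ {c} → IsClusterDeletionValue G c →
             ∀ D → ∃ λ x → x ≤ c × rowKernel (bestMatrix x) ≼[ G ] sameCluster D
  family-≼ {c} cdv D with crossing G (sameCluster D) ≤? c
  ... | yes x≤c = crossing G (sameCluster D) , x≤c , bestMatrix-≼ (kernel-isBoolEquivalence _≟_ (clusterOf D))
  ... | no x≰c with K , K-equiv , crossing≡c , crossing+pairCount≡ ← clusterDeletion-partition cdv =
    c , ≤-refl , ≼-trans {G = G} {Q = K} {S = sameCluster D} best≼K K≼D
    where
    best≼K : rowKernel (bestMatrix c) ≼[ G ] K
    best≼K = subst (λ x → rowKernel (bestMatrix x) ≼[ G ] K) crossing≡c (bestMatrix-≼ K-equiv)
    K≼D : K ≼[ G ] sameCluster D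
    K≼D = ≤-trans (≤-reflexive crossing≡c) (<⇒≤ (≰⇒> x≰c)) ,
          ≤-trans (≤-reflexive crossing+pairCount≡) (numEdges≤crossing+pairCount G (sameCluster D))

  family-dominates : ∀ {c} → IsClusterDeletionValue G c → ∀ {lam} → 0ℚ ≤ℚ lam → lam ≤ℚ 1ℚ →
                     ∀ D → ∃ λ M → M ∈ family c × LamPrime G M lam ≤ℚ LamPrime G D lam
  family-dominates cdv {lam} 0≤lam lam≤1 D with x , x≤c , best≼D ← family-≼ cdv D =
    bestClustering x , bestClustering∈family x≤c ,
    subst₂ _≤ℚ_ (sym (LamPrime-bestClustering x lam)) (sym (LamPrime≡cost G D lam))
                (cost-mono G 0≤lam lam≤1 best≼D)

theorem2 : ∀ (n : ℕ) (G : Graph n) (c : ℕ)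
    → IsClusterDeletionValue G c
    → 0 < numEdges G
    → Σ (List (Clustering n)) λ F
        → length F ≤ suc c
        × suc c ≤ numEdges G
        × (∀ (lam : ℚ) → 0ℚ <ℚ lam → lam <ℚ 1ℚ → ∃ λ Cl → Cl ∈ F × Optimal G Cl lam)
theorem2 n G c cdv 0<|E| =
  family G c , ≤-reflexive (length-family G c) , clusterDeletionValue<numEdges G cdv 0<|E| ,
  λ lam 0<lam lam<1 → dominated⇒minimum∈ (λ Cl → LamPrime G Cl lam) (bestClustering∈family G z≤n)
                                        (family-dominates G cdv (ℚₚ.<⇒≤ 0<lam) (ℚₚ.<⇒≤ lam<1))
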